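{- Let $A,B \in \{I, D, C\}$ and let $\mathcal{V}_{A,B}$ be the set of Cayley permutations that are vertical juxtapositions of a (possibly empty) sequence of type $A$ with a (possibly empty) sequence of type $B$, where type $I$ means strictly increasing, $D$ strictly decreasing and $C$ constant. For $n\ge 1$, let $a_1b_1a_2b_2\cdots a_nb_n$ be the vertical alternation of size $2n$ lying in $\mathcal{V}_{A,B}$, i.e. the Cayley permutation with $b_i > a_j$ for all $1\le i,j\le n$ such that $a_1\cdots a_n$ is of type $A$ and $b_1\cdots b_n$ is of type $B$. Then this Cayley permutation contains every element of $\mathcal{V}_{A,B}$ of size at most $n$.
   Context: A Cayley permutation is a word over the positive integers in which every integer between $1$ and its maximum occurs. Standardisation replaces the smallest value of a word by $1$, the next smallest by $2$, etc.; $w$ contains $p$ if some subsequence of $w$ standardises to $p$. A Cayley permutation $\pi$ with maximum value $n+k$ is a vertical juxtaposition of a Cayley permutation $\sigma$ with maximum $n$ and a Cayley permutation $\tau$ with maximum $k$ if the subsequence of entries of $\pi$ with values at most $n$ standardises to $\sigma$ and the subsequence of entries with values larger than $n$ standardises to $\tau$. -}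

module Defs where

open import Data.Nat using (ℕ; zero; suc; _≤_; _<_; _⊔_; _≤?_; _<?_; _≟_)
open import Data.List using (List; []; _∷_; length; map; filter; foldr; deduplicate)
open import Data.List.Relation.Unary.All using (All)
open import Data.List.Relation.Unary.AllPairs using (AllPairs)
open import Data.List.Membership.Propositional using (_∈_)
open import Data.List.Relation.Binary.Sublist.Propositional using (_⊆_)
open import Data.Product using (Σ; _×_; ∃-syntax)
open import Relation.Binary.PropositionalEquality using (_≡_)

maxW : List ℕ → ℕ
maxW = foldr _⊔_ 0

IsCayley : List ℕ → Set
IsCayley w = All (λ x → 1 ≤ x) w × (∀ k → 1 ≤ k → k ≤ maxW w → k ∈ w)

st : List ℕ → List ℕ
st w = map (λ x → suc (length (deduplicate _≟_ (filter (λ y → y <? x) w)))) w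

Contains : List ℕ → List ℕ → Set
Contains w p = ∃[ u ] (u ⊆ w × st u ≡ p)

VertJux : List ℕ → List ℕ → List ℕ → Set
VertJux π σ τ =
  IsCayley π × IsCayley σ × IsCayley τ ×
  maxW π ≡ maxW σ + maxW τ ×
  st (filter (λ x → x ≤? maxW σ) π) ≡ σ ×
  st (filter (λ x → maxW σ <? x) π) ≡ τ
  where open Data.Nat using (_+_)

data Ty : Set where
  I D C : Ty

HasType : Ty → List ℕ → Set
HasType I w = AllPairs _<_ w
HasType D w = AllPairs (λ x y → y < x) w
HasType C w = AllPairs _≡_ w

InV : Ty → Ty → List ℕ → Set
InV A B π = ∃[ σ ] ∃[ τ ] (HasType A σ × HasType B τ × VertJux π σ τ)

interleave : List ℕ → List ℕ → List ℕ
interleave [] bs = bs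
interleave (a ∷ as) [] = a ∷ as
interleave (a ∷ as) (b ∷ bs) = a ∷ b ∷ interleave as bs

-- Match the i-th entry of π with aᵢ if it lies in the lower part of π (value at most max σ) and
-- with bᵢ otherwise.  Within each part, π and the chosen letters are monotone of the same type,
-- and every a lies below every b, so the chosen subsequence is order-isomorphic to π.
-- Order-isomorphic words have the same standardisation, and the Cayley permutation π is its own.
module Submission where

open import Defs
open import Data.Nat using (ℕ; zero; suc; _≤_; _<_; _≤?_; _<?_; _≟_; z≤n; s≤s)
open import Data.Nat.Properties
  using (≤-refl; ≤-trans; ≤-reflexive; <⇒≱; ≮⇒≥; ≰⇒>; <-irrefl; <-asym; <-cmp; ≤-<-trans;
         n≤1+n; m≤n⇒m≤1+n; m≤n⇒m<n∨m≡n; m≤m⊔n; m≤n⊔m)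
open import Data.List using (List; []; _∷_; length; map; filter; deduplicate; downFrom)
open import Data.List.Properties using (length-map; map-∘; map-cong-local; map-id-local; filter-accept; filter-reject)
open import Data.List.Relation.Unary.All as All using (All; []; _∷_)
open import Data.List.Relation.Unary.AllPairs as AllPairs using (AllPairs; []; _∷_)
open import Data.List.Relation.Unary.AllPairs.Properties using (map⁻)
open import Data.List.Relation.Unary.Any using (here; there)
open import Data.List.Relation.Unary.Unique.Propositional using (Unique)
open import Data.List.Relation.Unary.Unique.Propositional.Properties using (downFrom⁺) renaming (filter⁺ to unique-filter⁺)
open import Data.List.Relation.Unary.Unique.DecPropositional.Properties _≟_ using (deduplicate-!)
open import Data.List.Membership.Propositional using (_∈_)
open import Data.List.Membership.Propositional.Properties
  using (∈-filter⁺; ∈-filter⁻; ∈-deduplicate⁺; ∈-deduplicate⁻; ∈-downFrom⁺; ∈-downFrom⁻)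
open import Data.List.Membership.Propositional.Properties.WithK using (unique∧set⇒bag)
open import Data.List.Membership.DecPropositional _≟_ using (_∈?_)
open import Data.List.Relation.Binary.BagAndSetEquality using (∼bag⇒↭)
open import Data.List.Relation.Binary.Permutation.Propositional.Properties using (↭-length)
open import Data.List.Relation.Binary.Sublist.Propositional using (_⊆_; _∷_; _∷ʳ_; minimum)
open import Data.Product using (_×_; _,_; proj₁; proj₂; swap; uncurry)
import Data.Product as Product
open import Data.Sum using (_⊎_; inj₁; inj₂)
import Data.Sum as Sum
open import Data.Empty using (⊥-elim)
open import Function using (_∘_; const)
open import Function.Bundles using (_⇔_; mk⇔; Equivalence)
open import Function.Construct.Symmetry using (⇔-sym)
open import Relation.Nullary using (¬_; yes; no; ¬?; contradiction)
open import Level using (0ℓ)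
open import Relation.Unary using (Pred; Decidable)
import Relation.Binary as Binary
open import Relation.Binary.Definitions using (tri<; tri≈; tri>)
open import Relation.Binary.PropositionalEquality using (_≡_; refl; sym; trans; cong; subst; module ≡-Reasoning)

private
  variable
    X : Set

filter-map : ∀ {P : Pred ℕ 0ℓ} (P? : Decidable P) (f : X → ℕ) xs →
  filter P? (map f xs) ≡ map f (filter (P? ∘ f) xs)
filter-map P? f [] = refl
filter-map P? f (x ∷ xs) with P? (f x)
... | yes _ = cong (f x ∷_) (filter-map P? f xs)
... | no _ = filter-map P? f xs

filter-cong-∈ : ∀ {P Q : Pred X 0ℓ} (P? : Decidable P) (Q? : Decidable Q) {xs} →
  (∀ {x} → x ∈ xs → P x ⇔ Q x) → filter P? xs ≡ filter Q? xs
filter-cong-∈ P? Q? {[]} _ = refl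
filter-cong-∈ P? Q? {x ∷ xs} P⇔Q with P? x | Q? x
... | yes _ | yes _ = cong (x ∷_) (filter-cong-∈ P? Q? (P⇔Q ∘ there))
... | no _ | no _ = filter-cong-∈ P? Q? (P⇔Q ∘ there)
... | yes px | no ¬qx = contradiction (Equivalence.to (P⇔Q (here refl)) px) ¬qx
... | no ¬px | yes qx = contradiction (Equivalence.from (P⇔Q (here refl)) qx) ¬px

deduplicate-map : ∀ (f : X → ℕ) xs →
  deduplicate _≟_ (map f xs) ≡ map f (deduplicate (λ x y → f x ≟ f y) xs)
deduplicate-map f [] = refl
deduplicate-map f (x ∷ xs) = cong (f x ∷_) (trans
  (cong (filter (¬? ∘ (f x ≟_))) (deduplicate-map f xs))
  (filter-map (¬? ∘ (f x ≟_)) f (deduplicate (λ u v → f u ≟ f v) xs)))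

deduplicate-cong-∈ : ∀ {R S : Binary.Rel X 0ℓ} (R? : Binary.Decidable R) (S? : Binary.Decidable S) {xs} →
  (∀ {x y} → x ∈ xs → y ∈ xs → R x y ⇔ S x y) → deduplicate R? xs ≡ deduplicate S? xs
deduplicate-cong-∈ R? S? {[]} _ = refl
deduplicate-cong-∈ {R = R} {S} R? S? {x ∷ xs} R⇔S =
  cong (x ∷_) (trans
    (cong (filter (¬? ∘ R? x)) (deduplicate-cong-∈ R? S? (λ p q → R⇔S (there p) (there q))))
    (filter-cong-∈ _ _ ¬R⇔¬S))
  where
  ¬R⇔¬S : ∀ {y} → y ∈ deduplicate S? xs → (¬ R x y) ⇔ (¬ S x y)
  ¬R⇔¬S y∈ = let R⇔S[x,y] = R⇔S (here refl) (there (∈-deduplicate⁻ S? xs y∈)) in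
    mk⇔ (λ ¬r s → ¬r (Equivalence.from R⇔S[x,y] s)) (λ ¬s r → ¬s (Equivalence.to R⇔S[x,y] r))

unique∧set⇒length≡ : ∀ {xs ys : List X} → Unique xs → Unique ys →
  (∀ {z} → z ∈ xs ⇔ z ∈ ys) → length xs ≡ length ys
unique∧set⇒length≡ !xs !ys xs⇔ys = ↭-length (∼bag⇒↭ (unique∧set⇒bag !xs !ys xs⇔ys))

allPairs-∈ : ∀ {R : Binary.Rel X 0ℓ} {xs} → (∀ {x y} → x ∈ xs → y ∈ xs → R x y) → AllPairs R xs
allPairs-∈ {xs = []} _ = []
allPairs-∈ {xs = x ∷ xs} r = All.tabulate (r (here refl) ∘ there) ∷ allPairs-∈ (λ p q → r (there p) (there q))

allPairs⇒∈ : ∀ {R : Binary.Rel X 0ℓ} → Binary.Reflexive R → Binary.Symmetric R →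
  ∀ {xs x y} → AllPairs R xs → x ∈ xs → y ∈ xs → R x y
allPairs⇒∈ refl′ sym′ (_ ∷ _) (here refl) (here refl) = refl′
allPairs⇒∈ refl′ sym′ (rx ∷ _) (here refl) (there q) = All.lookup rx q
allPairs⇒∈ refl′ sym′ (rx ∷ _) (there p) (here refl) = sym′ (All.lookup rx p)
allPairs⇒∈ refl′ sym′ (_ ∷ rxs) (there p) (there q) = allPairs⇒∈ refl′ sym′ rxs p q

allPairs-filter⁻ : ∀ {P : Pred X 0ℓ} (P? : Decidable P) {R : Binary.Rel X 0ℓ} {xs} →
  AllPairs R (filter P? xs) → AllPairs (λ x y → P x → P y → R x y) xs
allPairs-filter⁻ P? {xs = []} [] = []
allPairs-filter⁻ P? {xs = x ∷ xs} rs with P? x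
... | yes _ = All.tabulate (λ y∈ _ py → All.lookup (AllPairs.head rs) (∈-filter⁺ P? y∈ py))
              ∷ allPairs-filter⁻ P? (AllPairs.tail rs)
... | no ¬px = All.tabulate (λ _ px → contradiction px ¬px) ∷ allPairs-filter⁻ P? rs

maxW-≥ : ∀ {x w} → x ∈ w → x ≤ maxW w
maxW-≥ {w = y ∷ w} (here refl) = m≤m⊔n y (maxW w)
maxW-≥ {w = y ∷ w} (there p) = ≤-trans (maxW-≥ p) (m≤n⊔m y (maxW w))

-- A list zs with AllPairs SameOrder zs encodes two order-isomorphic words, map proj₁ zs and map proj₂ zs.
SameOrder : ℕ × ℕ → ℕ × ℕ → Set
SameOrder (a , x) (b , y) = (a < b ⇔ x < y) × (b < a ⇔ y < x)

sameOrder-refl : Binary.Reflexive SameOrder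
sameOrder-refl = mk⇔ (⊥-elim ∘ <-irrefl refl) (⊥-elim ∘ <-irrefl refl) ,
                 mk⇔ (⊥-elim ∘ <-irrefl refl) (⊥-elim ∘ <-irrefl refl)

sameOrder-sym : Binary.Symmetric SameOrder
sameOrder-sym = swap

sameOrder-transpose : ∀ {a x b y} → SameOrder (a , x) (b , y) → SameOrder (x , a) (y , b)
sameOrder-transpose (a<b⇔x<y , b<a⇔y<x) = ⇔-sym a<b⇔x<y , ⇔-sym b<a⇔y<x

sameOrder-≡ : ∀ {a x b y} → SameOrder (a , x) (b , y) → a ≡ b → x ≡ y
sameOrder-≡ {x = x} {y = y} (a<b⇔x<y , b<a⇔y<x) a≡b with <-cmp x y
... | tri< x<y _ _ = ⊥-elim (<-irrefl a≡b (Equivalence.from a<b⇔x<y x<y))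
... | tri≈ _ x≡y _ = x≡y
... | tri> _ _ y<x = ⊥-elim (<-irrefl (sym a≡b) (Equivalence.from b<a⇔y<x y<x))

sameOrder-≡⇔ : ∀ {z z′} → SameOrder z z′ → proj₁ z ≡ proj₁ z′ ⇔ proj₂ z ≡ proj₂ z′
sameOrder-≡⇔ so = mk⇔ (sameOrder-≡ so) (sameOrder-≡ (sameOrder-transpose so))

Ordered : Ty → ℕ → ℕ → Set
Ordered I x y = x < y
Ordered D x y = y < x
Ordered C x y = x ≡ y

hasType⇒ordered : ∀ A {w} → HasType A w → AllPairs (Ordered A) w
hasType⇒ordered I h = h
hasType⇒ordered D h = h
hasType⇒ordered C h = h

ordered⇒sameOrder : ∀ A {a b x y} → Ordered A a b → Ordered A x y → SameOrder (a , x) (b , y)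
ordered⇒sameOrder I a<b x<y =
  mk⇔ (const x<y) (const a<b) , mk⇔ (⊥-elim ∘ <-asym a<b) (⊥-elim ∘ <-asym x<y)
ordered⇒sameOrder D b<a y<x = sameOrder-sym (ordered⇒sameOrder I b<a y<x)
ordered⇒sameOrder C refl refl = sameOrder-refl

ordered-reflect : ∀ A {a b x y} → SameOrder (a , x) (b , y) → Ordered A x y → Ordered A a b
ordered-reflect I (a<b⇔x<y , _) = Equivalence.from a<b⇔x<y
ordered-reflect D (_ , b<a⇔y<x) = Equivalence.from b<a⇔y<x
ordered-reflect C so = sameOrder-≡ (sameOrder-transpose so)

-- st w is map (rank w) w by definition.
rank : List ℕ → ℕ → ℕ
rank w x = suc (length (deduplicate _≟_ (filter (_<? x) w)))

valuesBelow : List ℕ → ℕ → List ℕ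
valuesBelow w x = filter (_∈? w) (downFrom x)

rank≡ : ∀ w x → rank w x ≡ suc (length (valuesBelow w x))
rank≡ w x =
  cong suc (unique∧set⇒length≡ (deduplicate-! _) (unique-filter⁺ (_∈? w) (downFrom⁺ x)) (mk⇔ to from))
  where
  to : ∀ {z} → z ∈ deduplicate _≟_ (filter (_<? x) w) → z ∈ valuesBelow w x
  to z∈ with z∈w , z<x ← ∈-filter⁻ (_<? x) (∈-deduplicate⁻ _≟_ _ z∈) =
    ∈-filter⁺ (_∈? w) (∈-downFrom⁺ z<x) z∈w
  from : ∀ {z} → z ∈ valuesBelow w x → z ∈ deduplicate _≟_ (filter (_<? x) w)
  from z∈ with z∈↓x , z∈w ← ∈-filter⁻ (_∈? w) z∈ =
    ∈-deduplicate⁺ _≟_ (∈-filter⁺ (_<? x) z∈w (∈-downFrom⁻ z∈↓x))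

valuesBelow-step : ∀ w x → length (valuesBelow w x) ≤ length (valuesBelow w (suc x))
valuesBelow-step w x with x ∈? w
... | yes _ = n≤1+n _
... | no _ = ≤-refl

valuesBelow-step< : ∀ w {x} → x ∈ w → length (valuesBelow w x) < length (valuesBelow w (suc x))
valuesBelow-step< w {x} x∈w with x ∈? w
... | yes _ = ≤-refl
... | no x∉w = contradiction x∈w x∉w

valuesBelow-mono : ∀ w {x y} → x ≤ y → length (valuesBelow w x) ≤ length (valuesBelow w y)
valuesBelow-mono w {y = zero} z≤n = ≤-refl
valuesBelow-mono w {y = suc y} x≤y with m≤n⇒m<n∨m≡n x≤y
... | inj₁ (s≤s x≤y′) = ≤-trans (valuesBelow-mono w x≤y′) (valuesBelow-step w y)
... | inj₂ refl = ≤-refl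

rank-mono : ∀ w {x y} → x ≤ y → rank w x ≤ rank w y
rank-mono w {x} {y} x≤y rewrite rank≡ w x | rank≡ w y = s≤s (valuesBelow-mono w x≤y)

rank-strict : ∀ w {x y} → x ∈ w → x < y → rank w x < rank w y
rank-strict w {x} {y} x∈w x<y rewrite rank≡ w x | rank≡ w y =
  s≤s (≤-trans (valuesBelow-step< w x∈w) (valuesBelow-mono w x<y))

rank-cancel-< : ∀ w {x y} → rank w x < rank w y → x < y
rank-cancel-< w {x} {y} r<r with x <? y
... | yes x<y = x<y
... | no x≮y = contradiction (rank-mono w (≮⇒≥ x≮y)) (<⇒≱ r<r)

sameOrder-rank : ∀ w {x y} → x ∈ w → y ∈ w → SameOrder (x , rank w x) (y , rank w y)
sameOrder-rank w x∈w y∈w =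
  mk⇔ (rank-strict w x∈w) (rank-cancel-< w) , mk⇔ (rank-strict w y∈w) (rank-cancel-< w)

ordered-st⁻ : ∀ A {w} → AllPairs (Ordered A) (st w) → AllPairs (Ordered A) w
ordered-st⁻ A {w} h =
  AllPairs.map (uncurry (ordered-reflect A)) (AllPairs.zip (allPairs-∈ (sameOrder-rank w) , map⁻ h))

valuesBelow-full : ∀ {w} → ¬ 0 ∈ w → ∀ x → (∀ {k} → 1 ≤ k → k ≤ x → k ∈ w) →
  length (valuesBelow w (suc x)) ≡ x
valuesBelow-full {w} 0∉w zero _ = cong length (filter-reject (_∈? w) {xs = []} 0∉w)
valuesBelow-full {w} 0∉w (suc x) full =
  trans (cong length (filter-accept (_∈? w) {xs = downFrom (suc x)} (full (s≤s z≤n) ≤-refl)))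
        (cong suc (valuesBelow-full 0∉w x (λ 1≤k k≤x → full 1≤k (m≤n⇒m≤1+n k≤x))))

rank-cayley : ∀ {w x} → IsCayley w → x ∈ w → rank w x ≡ x
rank-cayley {w} {x} (positive , full) x∈w with All.lookup positive x∈w
... | s≤s {n = x′} _ = trans (rank≡ w x) (cong suc (valuesBelow-full 0∉w x′ full′))
  where
  0∉w : ¬ 0 ∈ w
  0∉w 0∈w with () ← All.lookup positive 0∈w
  full′ : ∀ {k} → 1 ≤ k → k ≤ x′ → k ∈ w
  full′ 1≤k k≤x′ = full _ 1≤k (≤-trans (m≤n⇒m≤1+n k≤x′) (maxW-≥ x∈w))

st-cayley : ∀ {w} → IsCayley w → st w ≡ w
st-cayley c = map-id-local (All.tabulate (rank-cayley c))

rank-map : ∀ (f : X → ℕ) xs y →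
  rank (map f xs) y ≡ suc (length (deduplicate (λ u v → f u ≟ f v) (filter (λ v → f v <? y) xs)))
rank-map {X} f xs y = begin
  rank (map f xs) y                             ≡⟨ cong (suc ∘ length ∘ deduplicate _≟_) (filter-map (_<? y) f xs) ⟩
  suc (length (deduplicate _≟_ (map f below)))  ≡⟨ cong (suc ∘ length) (deduplicate-map f below) ⟩
  suc (length (map f distinct))                 ≡⟨ cong suc (length-map f distinct) ⟩
  suc (length distinct)                         ∎
  where
  open ≡-Reasoning
  below distinct : List X
  below = filter (λ v → f v <? y) xs
  distinct = deduplicate (λ u v → f u ≟ f v) below

st-sameOrder : ∀ {zs} → AllPairs SameOrder zs → st (map proj₁ zs) ≡ st (map proj₂ zs)
st-sameOrder {zs} so = begin
  map (rank (map proj₁ zs)) (map proj₁ zs)   ≡⟨ map-∘ zs ⟨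
  map (rank (map proj₁ zs) ∘ proj₁) zs       ≡⟨ map-cong-local (All.tabulate ranks≡) ⟩
  map (rank (map proj₂ zs) ∘ proj₂) zs       ≡⟨ map-∘ zs ⟩
  map (rank (map proj₂ zs)) (map proj₂ zs)   ∎
  where
  open ≡-Reasoning
  related : ∀ {z z′} → z ∈ zs → z′ ∈ zs → SameOrder z z′
  related = allPairs⇒∈ sameOrder-refl sameOrder-sym so
  distinct : (ℕ × ℕ → ℕ) → List (ℕ × ℕ) → ℕ
  distinct f vs = length (deduplicate (λ u v → f u ≟ f v) vs)
  ranks≡ : ∀ {z} → z ∈ zs → rank (map proj₁ zs) (proj₁ z) ≡ rank (map proj₂ zs) (proj₂ z)
  ranks≡ {z} z∈ = begin
    rank (map proj₁ zs) (proj₁ z)  ≡⟨ rank-map proj₁ zs (proj₁ z) ⟩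
    suc (distinct proj₁ below₁)    ≡⟨ cong (suc ∘ length) (deduplicate-cong-∈ _ _ same-values) ⟩
    suc (distinct proj₂ below₁)    ≡⟨ cong (suc ∘ distinct proj₂) (filter-cong-∈ _ _ (proj₂ ∘ related z∈)) ⟩
    suc (distinct proj₂ below₂)    ≡⟨ rank-map proj₂ zs (proj₂ z) ⟨
    rank (map proj₂ zs) (proj₂ z)  ∎
    where
    below₁ below₂ : List (ℕ × ℕ)
    below₁ = filter (λ v → proj₁ v <? proj₁ z) zs
    below₂ = filter (λ v → proj₂ v <? proj₂ z) zs
    same-values : ∀ {u v} → u ∈ below₁ → v ∈ below₁ → proj₁ u ≡ proj₁ v ⇔ proj₂ u ≡ proj₂ v
    same-values u∈ v∈ = sameOrder-≡⇔ (related (below⊆ u∈) (below⊆ v∈))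
      where
      below⊆ : ∀ {v} → v ∈ below₁ → v ∈ zs
      below⊆ = proj₁ ∘ ∈-filter⁻ (λ v → proj₁ v <? proj₁ z)

embed : ℕ → List ℕ → List ℕ → List ℕ → List (ℕ × ℕ)
embed p [] _ _ = []
embed p (x ∷ π) [] _ = []
embed p (x ∷ π) (a ∷ as) [] = []
embed p (x ∷ π) (a ∷ as) (b ∷ bs) with x ≤? p
... | yes _ = (a , x) ∷ embed p π as bs
... | no _ = (b , x) ∷ embed p π as bs

embed-⊆ : ∀ p π as bs → map proj₁ (embed p π as bs) ⊆ interleave as bs
embed-⊆ p [] as bs = minimum _
embed-⊆ p (x ∷ π) [] bs = minimum _
embed-⊆ p (x ∷ π) (a ∷ as) [] = minimum _
embed-⊆ p (x ∷ π) (a ∷ as) (b ∷ bs) with x ≤? p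
... | yes _ = refl ∷ (b ∷ʳ embed-⊆ p π as bs)
... | no _ = a ∷ʳ (refl ∷ embed-⊆ p π as bs)

embed-proj₂ : ∀ p π as bs → length π ≤ length as → length π ≤ length bs → map proj₂ (embed p π as bs) ≡ π
embed-proj₂ p [] as bs _ _ = refl
embed-proj₂ p (x ∷ π) (a ∷ as) (b ∷ bs) (s≤s π≤as) (s≤s π≤bs) with x ≤? p
... | yes _ = cong (x ∷_) (embed-proj₂ p π as bs π≤as π≤bs)
... | no _ = cong (x ∷_) (embed-proj₂ p π as bs π≤as π≤bs)

Placed : ℕ → List ℕ → List ℕ → List ℕ → ℕ × ℕ → Set
Placed p π as bs (c , y) = y ∈ π × (y ≤ p × c ∈ as ⊎ p < y × c ∈ bs)

placed-∷ : ∀ {p x π a as b bs z} → Placed p π as bs z → Placed p (x ∷ π) (a ∷ as) (b ∷ bs) z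
placed-∷ = Product.map there (Sum.map (Product.map₂ there) (Product.map₂ there))

embed-placed : ∀ p π as bs {z} → z ∈ embed p π as bs → Placed p π as bs z
embed-placed p (x ∷ π) (a ∷ as) (b ∷ bs) z∈ with x ≤? p
embed-placed p (x ∷ π) (a ∷ as) (b ∷ bs) (here refl) | yes x≤p = here refl , inj₁ (x≤p , here refl)
embed-placed p (x ∷ π) (a ∷ as) (b ∷ bs) (here refl) | no x≰p = here refl , inj₂ (≰⇒> x≰p , here refl)
embed-placed p (x ∷ π) (a ∷ as) (b ∷ bs) (there z∈) | yes _ = placed-∷ (embed-placed p π as bs z∈)
embed-placed p (x ∷ π) (a ∷ as) (b ∷ bs) (there z∈) | no _ = placed-∷ (embed-placed p π as bs z∈)

Juxtaposed : Ty → Ty → ℕ → ℕ → ℕ → Set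
Juxtaposed A B p x y = (x ≤ p → y ≤ p → Ordered A x y) × (p < x → p < y → Ordered B x y)

embed-sameOrder : ∀ A B p π as bs →
  AllPairs (Juxtaposed A B p) π → AllPairs (Ordered A) as → AllPairs (Ordered B) bs →
  All (λ b → All (_< b) as) bs → AllPairs SameOrder (embed p π as bs)
embed-sameOrder A B p [] as bs _ _ _ _ = []
embed-sameOrder A B p (x ∷ π) [] bs _ _ _ _ = []
embed-sameOrder A B p (x ∷ π) (a ∷ as) [] _ _ _ _ = []
embed-sameOrder A B p (x ∷ π) (a ∷ as) (b ∷ bs) (jx ∷ jπ) (oa ∷ oas) (ob ∷ obs) (as<b ∷ as<bs) with x ≤? p
... | yes x≤p = All.tabulate (low ∘ embed-placed p π as bs)
              ∷ embed-sameOrder A B p π as bs jπ oas obs (All.map All.tail as<bs)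
  where
  low : ∀ {z} → Placed p π as bs z → SameOrder (a , x) z
  low (y∈ , inj₁ (y≤p , c∈as)) =
    ordered⇒sameOrder A (All.lookup oa c∈as) (proj₁ (All.lookup jx y∈) x≤p y≤p)
  low (_ , inj₂ (p<y , c∈bs)) =
    ordered⇒sameOrder I (All.head (All.lookup as<bs c∈bs)) (≤-<-trans x≤p p<y)
... | no x≰p = All.tabulate (high ∘ embed-placed p π as bs)
             ∷ embed-sameOrder A B p π as bs jπ oas obs (All.map All.tail as<bs)
  where
  high : ∀ {z} → Placed p π as bs z → SameOrder (b , x) z
  high (_ , inj₁ (y≤p , c∈as)) =
    sameOrder-sym (ordered⇒sameOrder I (All.lookup as<b (there c∈as)) (≤-<-trans y≤p (≰⇒> x≰p)))
  high (y∈ , inj₂ (p<y , c∈bs)) =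
    ordered⇒sameOrder B (All.lookup ob c∈bs) (proj₂ (All.lookup jx y∈) (≰⇒> x≰p) p<y)

lemma3p2 : (A B : Ty) (n : ℕ) → 1 ≤ n → (as bs : List ℕ) →
    length as ≡ n → length bs ≡ n →
    HasType A as → HasType B bs →
    All (λ b → All (λ a → a < b) as) bs →
    IsCayley (interleave as bs) →
    (π : List ℕ) → InV A B π → length π ≤ n →
    Contains (interleave as bs) π
lemma3p2 A B n _ as bs |as| |bs| tA tB as<bs _ π (σ , τ , tσ , tτ , cayley , _ , _ , _ , stLow , stHigh) |π|≤n =
  map proj₁ zs , embed-⊆ p π as bs , (begin
    st (map proj₁ zs)  ≡⟨ st-sameOrder order-isomorphic ⟩
    st (map proj₂ zs)  ≡⟨ cong st (embed-proj₂ p π as bs (π-fits as |as|) (π-fits bs |bs|)) ⟩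
    st π               ≡⟨ st-cayley cayley ⟩
    π                  ∎)
  where
  open ≡-Reasoning
  p : ℕ
  p = maxW σ
  zs : List (ℕ × ℕ)
  zs = embed p π as bs
  low : AllPairs (Ordered A) (filter (_≤? p) π)
  low = ordered-st⁻ A (subst (AllPairs (Ordered A)) (sym stLow) (hasType⇒ordered A tσ))
  high : AllPairs (Ordered B) (filter (p <?_) π)
  high = ordered-st⁻ B (subst (AllPairs (Ordered B)) (sym stHigh) (hasType⇒ordered B tτ))
  juxtaposed : AllPairs (Juxtaposed A B p) π
  juxtaposed = AllPairs.zip (allPairs-filter⁻ (_≤? p) low , allPairs-filter⁻ (p <?_) high)
  order-isomorphic : AllPairs SameOrder zs
  order-isomorphic =
    embed-sameOrder A B p π as bs juxtaposed (hasType⇒ordered A tA) (hasType⇒ordered B tB) as<bs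
  π-fits : ∀ xs → length xs ≡ n → length π ≤ length xs
  π-fits xs |xs| = ≤-trans |π|≤n (≤-reflexive (sym |xs|))
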